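{- Given a string $S[1\ldots n]$ and an index $x\in[1\ldots n]$, there are $O(\log(n))$ extremely periodic runs of $S$ containing $x$.
   Context: An integer $p$ is a period of a string $X$ if $X[i]=X[i+p]$ for all valid $i$; $per(X)$ is the smallest period. A substring $R=S[i\ldots j]$ is a run if $per(R)\le |R|/2$... more precisely, if it is periodic with period $p=per(R)<\frac{|R|}{2}$ and it cannot be extended while keeping period $p$: $S[i-1]\neq S[i-1+p]$ (unless $i=1$) and $S[j+1]\neq S[j+1-p]$ (unless $j=n$). A string $X$ is extremely periodic if $per(X)\le\frac{|X|}{5}$. A run $S[i\ldots j]$ contains $x$ if $x\in[i\ldots j]$. -}

module Defs where

open import Data.Nat using (ℕ; zero; suc; _+_; _*_; _≤_; _<_)
open import Data.Fin using (Fin; toℕ)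
open import Data.Product using (Σ; _×_)
open import Relation.Binary.PropositionalEquality using (_≡_; _≢_)

-- Conventions: a string S[1..n] over alphabet A is a function S : Fin n → A,
-- positions are 0-indexed: paper position k corresponds to index k-1.
-- The substring S[i..j] (inclusive, 0-indexed) has length j + 1 - i.

module _ {A : Set} {n : ℕ} (S : Fin n → A) where

  IsPeriod : ℕ → ℕ → ℕ → Set
  IsPeriod i j p = (0 < p) × ((a b : Fin n) → i ≤ toℕ a → toℕ b ≤ j →
                     toℕ b ≡ toℕ a + p → S a ≡ S b)

  IsPer : ℕ → ℕ → ℕ → Set
  IsPer i j p = IsPeriod i j p × ((q : ℕ) → IsPeriod i j q → p ≤ q)

  IsRunWithPer : ℕ → ℕ → ℕ → Set
  IsRunWithPer i j p =
    (i ≤ j) × (j < n) × IsPer i j p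
    × (2 * p + i < suc j)
    -- left maximality (vacuous when i = 0): S[i-1] ≠ S[i-1+p]
    × ((a b : Fin n) → suc (toℕ a) ≡ i → toℕ b ≡ toℕ a + p → S a ≢ S b)
    -- right maximality (vacuous when j = n-1): S[j+1] ≠ S[j+1-p]
    × ((a b : Fin n) → toℕ b ≡ suc j → toℕ b ≡ toℕ a + p → S a ≢ S b)

  IsRun : ℕ → ℕ → Set
  IsRun i j = Σ ℕ (λ p → IsRunWithPer i j p)

  IsExtremelyPeriodicRun : ℕ → ℕ → Set
  IsExtremelyPeriodicRun i j = Σ ℕ (λ p → IsRunWithPer i j p × (5 * p + i ≤ suc j))

-- Class the extremely periodic runs [i..j] containing x by the half of the run that contains x
-- and by ⌊log₂ p²⌋ for their period p; there are O(log n) classes.  Take two runs of one class,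
-- say with x in their left halves.  The arms [x..j₁] and [x..j₂] are at least 5p₁/2 and 5p₂/2
-- long and the periods differ by a factor below √2, so the shorter arm has length at least
-- p₁ + p₂.  If p₁ < p₂, this shared window has the periods p₁ and p₂, hence p₂ − p₁, and since it
-- is longer than p₂ + (p₂ − p₁) that period spreads over the whole second run, contradicting the
-- minimality of p₂.  So p₁ = p₂, and then maximality of both runs forces them to coincide: each
-- class contains at most one run.

module Submission where

open import Defs
open import Data.Nat
open import Data.Nat.Properties
open ≤-Reasoning
open import Algebra.Properties.CommutativeSemigroup +-commutativeSemigroup using (xy∙z≈xz∙y)
open import Data.Nat.Logarithm using (⌊log₂_⌋; ⌊log₂⌋-mono-≤; ⌊log₂[2*b]⌋≡1+⌊log₂b⌋; ⌊log₂[2^n]⌋≡n)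
open import Data.Nat.Tactic.RingSolver using (solve; solve-∀)
import Data.Fin as Fin
open import Data.Fin using (Fin; toℕ; fromℕ<)
open import Data.Fin.Properties using (toℕ-fromℕ<; fromℕ<-injective; injective⇒≤)
open import Data.Product using (Σ; _×_; _,_; proj₁; proj₂)
open import Data.Sum using (_⊎_; inj₁; inj₂; [_,_]′)
open import Data.Empty using (⊥; ⊥-elim)
open import Relation.Nullary using (¬_; yes; no)
open import Relation.Binary.PropositionalEquality
open import Data.List using (List; []; _∷_; length; lookup)
open import Data.List.Membership.Propositional.Properties using (∈-lookup)
import Data.List.Relation.Unary.All as All
open import Data.List.Relation.Unary.All using (All)
import Data.List.Relation.Unary.AllPairs as AllPairs
open import Data.List.Relation.Unary.Unique.Propositional using (Unique)

Unique⇒lookup-injective : ∀ {X : Set} {xs : List X} → Unique xs →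
                          ∀ i j → lookup xs i ≡ lookup xs j → i ≡ j
Unique⇒lookup-injective (_ AllPairs.∷ _) Fin.zero Fin.zero _ = refl
Unique⇒lookup-injective (x∉xs AllPairs.∷ _) Fin.zero (Fin.suc j) eq = ⊥-elim (All.lookup x∉xs (∈-lookup j) eq)
Unique⇒lookup-injective (x∉xs AllPairs.∷ _) (Fin.suc i) Fin.zero eq = ⊥-elim (All.lookup x∉xs (∈-lookup i) (sym eq))
Unique⇒lookup-injective (_ AllPairs.∷ u) (Fin.suc i) (Fin.suc j) eq = cong Fin.suc (Unique⇒lookup-injective u i j eq)

length≤-by-injective-code : ∀ {X : Set} {P : X → Set} {xs : List X} (m : ℕ) → Unique xs → All P xs →
  (code : ∀ x → P x → ℕ) → (∀ x (px : P x) → code x px < m) →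
  (∀ x y (px : P x) (py : P y) → code x px ≡ code y py → x ≡ y) → length xs ≤ m
length≤-by-injective-code {P = P} {xs} m unique all code code<m code-injective = injective⇒≤ f-injective
  where
    P-at : ∀ i → P (lookup xs i)
    P-at i = All.lookup all (∈-lookup i)
    f : Fin (length xs) → Fin m
    f i = fromℕ< (code<m _ (P-at i))
    f-injective : ∀ {i j} → f i ≡ f j → i ≡ j
    f-injective {i} {j} fi≡fj = Unique⇒lookup-injective unique i j
      (code-injective _ _ (P-at i) (P-at j) (fromℕ<-injective _ _ (code<m _ (P-at i)) (code<m _ (P-at j)) fi≡fj))

⌊log₂⌋≡⇒<2* : ∀ m k .{{_ : NonZero m}} → ⌊log₂ m ⌋ ≡ ⌊log₂ k ⌋ → k < 2 * m
⌊log₂⌋≡⇒<2* m k eq = ≰⇒> λ 2*m≤k → 1+n≰n (begin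
  suc ⌊log₂ m ⌋     ≡⟨ sym (⌊log₂[2*b]⌋≡1+⌊log₂b⌋ m) ⟩
  ⌊log₂ (2 * m) ⌋   ≤⟨ ⌊log₂⌋-mono-≤ 2*m≤k ⟩
  ⌊log₂ k ⌋         ≡⟨ sym eq ⟩
  ⌊log₂ m ⌋         ∎)

n<2^[1+⌊log₂n⌋] : ∀ n → n < 2 ^ suc ⌊log₂ n ⌋
n<2^[1+⌊log₂n⌋] n = ≰⇒> λ 2^[1+⌊log₂n⌋]≤n → 1+n≰n (begin
  suc ⌊log₂ n ⌋                   ≡⟨ sym (⌊log₂[2^n]⌋≡n (suc ⌊log₂ n ⌋)) ⟩
  ⌊log₂ (2 ^ suc ⌊log₂ n ⌋) ⌋     ≤⟨ ⌊log₂⌋-mono-≤ 2^[1+⌊log₂n⌋]≤n ⟩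
  ⌊log₂ n ⌋                       ∎)

⌊log₂[m*m]⌋≤2*⌊log₂n⌋+2 : ∀ {m n} → m ≤ n → ⌊log₂ (m * m) ⌋ ≤ 2 * ⌊log₂ n ⌋ + 2
⌊log₂[m*m]⌋≤2*⌊log₂n⌋+2 {m} {n} m≤n = begin
  ⌊log₂ (m * m) ⌋                 ≤⟨ ⌊log₂⌋-mono-≤ (*-mono-≤ m≤2^[1+L] m≤2^[1+L]) ⟩
  ⌊log₂ (2 ^ suc L * 2 ^ suc L) ⌋ ≡⟨ cong ⌊log₂_⌋ (sym (^-distribˡ-+-* 2 (suc L) (suc L))) ⟩
  ⌊log₂ (2 ^ (suc L + suc L)) ⌋   ≡⟨ ⌊log₂[2^n]⌋≡n (suc L + suc L) ⟩
  suc L + suc L                   ≡⟨ 1+k+[1+k]≡2*k+2 L ⟩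
  2 * L + 2                       ∎
  where
    L = ⌊log₂ n ⌋
    m≤2^[1+L] : m ≤ 2 ^ suc L
    m≤2^[1+L] = ≤-trans m≤n (<⇒≤ (n<2^[1+⌊log₂n⌋] n))
    1+k+[1+k]≡2*k+2 : ∀ k → suc k + suc k ≡ 2 * k + 2
    1+k+[1+k]≡2*k+2 = solve-∀

q*q<2*[p*p]⇒2*q≤3*p+1 : ∀ p q → q * q < 2 * (p * p) → 2 * q ≤ 3 * p + 1
q*q<2*[p*p]⇒2*q≤3*p+1 p q q*q<2*[p*p] = ≮⇒≥ λ 3*p+1<2*q → <⇒≱ q*q<2*[p*p] (*-cancelˡ-≤ 4 (begin
  4 * (2 * (p * p))                          ≤⟨ m≤m+n _ (p * p + 12 * p + 4) ⟩
  4 * (2 * (p * p)) + (p * p + 12 * p + 4)   ≡⟨ solve (p ∷ []) ⟩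
  suc (3 * p + 1) * suc (3 * p + 1)          ≤⟨ *-mono-≤ 3*p+1<2*q 3*p+1<2*q ⟩
  2 * q * (2 * q)                            ≡⟨ solve (q ∷ []) ⟩
  4 * (q * q)                                ∎))

Close : ℕ → ℕ → Set
Close p q = p ≤ q × 2 * q ≤ 3 * p + 1

-- Squaring halves the width of a class: equal ⌊log₂ (p * p)⌋ confines the periods to a ratio below √2.
⌊log₂[p*p]⌋≡⇒Close : ∀ {p q} → 0 < p → 0 < q → ⌊log₂ (p * p) ⌋ ≡ ⌊log₂ (q * q) ⌋ → Close p q ⊎ Close q p
⌊log₂[p*p]⌋≡⇒Close {p@(suc _)} {q@(suc _)} _ _ eq with ≤-total p q
... | inj₁ p≤q = inj₁ (p≤q , q*q<2*[p*p]⇒2*q≤3*p+1 p q (⌊log₂⌋≡⇒<2* (p * p) (q * q) eq))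
... | inj₂ q≤p = inj₂ (q≤p , q*q<2*[p*p]⇒2*q≤3*p+1 q p (⌊log₂⌋≡⇒<2* (q * q) (p * p) (sym eq)))

wlog-Close : ∀ {X : Set} {p q} {u v : X} → 0 < p → 0 < q → ⌊log₂ (p * p) ⌋ ≡ ⌊log₂ (q * q) ⌋ →
             (Close p q → u ≡ v) → (Close q p → v ≡ u) → u ≡ v
wlog-Close p>0 q>0 eq u≡v v≡u with ⌊log₂[p*p]⌋≡⇒Close p>0 q>0 eq
... | inj₁ close = u≡v close
... | inj₂ close = sym (v≡u close)

Close⇒q≤p+p : ∀ {p q} → 0 < p → Close p q → q ≤ p + p
Close⇒q≤p+p {p} {q} p>0 (_ , 2*q≤3*p+1) = *-cancelˡ-≤ 2 (begin
  2 * q         ≤⟨ 2*q≤3*p+1 ⟩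
  3 * p + 1     ≤⟨ +-monoʳ-≤ (3 * p) p>0 ⟩
  3 * p + p     ≡⟨ solve (p ∷ []) ⟩
  2 * (p + p)   ∎)

Close⇒2*[p+q]≤5*p+1 : ∀ {p q} → Close p q → 2 * (p + q) ≤ 5 * p + 1
Close⇒2*[p+q]≤5*p+1 {p} {q} (_ , 2*q≤3*p+1) = begin
  2 * (p + q)         ≡⟨ *-distribˡ-+ 2 p q ⟩
  2 * p + 2 * q       ≤⟨ +-monoʳ-≤ (2 * p) 2*q≤3*p+1 ⟩
  2 * p + (3 * p + 1) ≡⟨ solve (p ∷ []) ⟩
  5 * p + 1           ∎

Close⇒2*[p+q]≤5*q+1 : ∀ {p q} → Close p q → 2 * (p + q) ≤ 5 * q + 1
Close⇒2*[p+q]≤5*q+1 {p} {q} (p≤q , _) = begin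
  2 * (p + q)             ≤⟨ *-monoʳ-≤ 2 (+-monoˡ-≤ q p≤q) ⟩
  2 * (q + q)             ≤⟨ m≤m+n _ (q + 1) ⟩
  2 * (q + q) + (q + 1)   ≡⟨ solve (q ∷ []) ⟩
  5 * q + 1               ∎

x+x≤i+j⇒x+s≤1+j : ∀ {r i j x s} → 5 * r + i ≤ suc j → x + x ≤ i + j → 2 * s ≤ 5 * r + 1 → x + s ≤ suc j
x+x≤i+j⇒x+s≤1+j {r} {i} {j} {x} {s} long x+x≤i+j 2*s≤5*r+1 = *-cancelˡ-≤ 2 (begin
  2 * (x + s)               ≡⟨ solve (x ∷ s ∷ []) ⟩
  (x + x) + 2 * s           ≤⟨ +-mono-≤ x+x≤i+j 2*s≤5*r+1 ⟩
  (i + j) + (5 * r + 1)     ≡⟨ solve (i ∷ j ∷ r ∷ []) ⟩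
  (5 * r + i) + suc j       ≤⟨ +-monoˡ-≤ (suc j) long ⟩
  suc j + suc j             ≡⟨ solve (j ∷ []) ⟩
  2 * suc j                 ∎)

i+j<x+x⇒i+s≤1+x : ∀ {r i j x s} → 5 * r + i ≤ suc j → i + j < x + x → 2 * s ≤ 5 * r + 1 → i + s ≤ suc x
i+j<x+x⇒i+s≤1+x {r} {i} {j} {x} {s} long i+j<x+x 2*s≤5*r+1 = *-cancelˡ-≤ 2 (begin
  2 * (i + s)               ≡⟨ solve (i ∷ s ∷ []) ⟩
  (i + i) + 2 * s           ≤⟨ +-monoʳ-≤ (i + i) 2*s≤5*r+1 ⟩
  (i + i) + (5 * r + 1)     ≡⟨ solve (i ∷ r ∷ []) ⟩
  (5 * r + i) + suc i       ≤⟨ +-monoˡ-≤ (suc i) long ⟩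
  suc j + suc i             ≡⟨ solve (i ∷ j ∷ []) ⟩
  suc (i + j) + 1           ≤⟨ +-monoˡ-≤ 1 i+j<x+x ⟩
  x + x + 1                 ≤⟨ +-monoʳ-≤ (x + x) (n≤1+n 1) ⟩
  x + x + 2                 ≡⟨ solve (x ∷ []) ⟩
  2 * suc x                 ∎)

2*L+3+[2*L+3]≤10*L : ∀ {L} → 1 ≤ L → (2 * L + 3) + (2 * L + 3) ≤ 10 * L
2*L+3+[2*L+3]≤10*L {suc k} _ = begin
  (2 * suc k + 3) + (2 * suc k + 3)           ≤⟨ m≤m+n _ (6 * k) ⟩
  (2 * suc k + 3) + (2 * suc k + 3) + 6 * k   ≡⟨ solve (k ∷ []) ⟩
  10 * suc k                                  ∎

module _ {A : Set} {n : ℕ} (S : Fin n → A) where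

  -- Vacuous when u or v is out of range, so chaining agreements needs the middle position in range.
  Agree : ℕ → ℕ → Set
  Agree u v = (a b : Fin n) → toℕ a ≡ u → toℕ b ≡ v → S a ≡ S b

  Agree-sym : ∀ {u v} → Agree u v → Agree v u
  Agree-sym uv a b a≡v b≡u = sym (uv b a b≡u a≡v)

  Agree-trans : ∀ {u v w} → v < n → Agree u v → Agree v w → Agree u w
  Agree-trans v<n uv vw a b a≡u b≡w =
    trans (uv a (fromℕ< v<n) a≡u (toℕ-fromℕ< v<n)) (vw (fromℕ< v<n) b (toℕ-fromℕ< v<n) b≡w)

  Periodic : ℕ → ℕ → ℕ → Set
  Periodic i j p = ∀ u → i ≤ u → u + p ≤ j → Agree u (u + p)

  IsPeriod⇒Periodic : ∀ {i j p} → IsPeriod S i j p → Periodic i j p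
  IsPeriod⇒Periodic {j = j} (_ , period) u i≤u u+p≤j a b refl b≡u+p =
    period a b i≤u (subst (_≤ j) (sym b≡u+p) u+p≤j) b≡u+p

  Periodic⇒IsPeriod : ∀ {i j p} → 0 < p → Periodic i j p → IsPeriod S i j p
  Periodic⇒IsPeriod {j = j} p>0 P =
    p>0 , λ a b i≤a b≤j b≡a+p → P (toℕ a) i≤a (subst (_≤ j) b≡a+p b≤j) a b refl b≡a+p

  Periodic-mono : ∀ {i j i′ j′ p} → i ≤ i′ → j′ ≤ j → Periodic i j p → Periodic i′ j′ p
  Periodic-mono i≤i′ j′≤j P u i′≤u u+p≤j′ = P u (≤-trans i≤i′ i′≤u) (≤-trans u+p≤j′ j′≤j)

  module _ {a b q} (b<n : b < n) (Q : Periodic a b q) {v g} (a≤v : a ≤ v) (v+g+q≤b : v + g + q ≤ b) where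

    private
      v+q+g≡v+g+q : v + q + g ≡ v + g + q
      v+q+g≡v+g+q = solve (v ∷ q ∷ g ∷ [])

      Agree-v : Agree v (v + q)
      Agree-v = Q v a≤v (≤-trans (m≤m+n (v + q) g) (subst (_≤ b) (sym v+q+g≡v+g+q) v+g+q≤b))

      Agree-v+g : Agree (v + g) (v + q + g)
      Agree-v+g = subst (Agree (v + g)) (sym v+q+g≡v+g+q) (Q (v + g) (≤-trans a≤v (m≤m+n v g)) v+g+q≤b)

      v+g+q<n : v + g + q < n
      v+g+q<n = ≤-<-trans v+g+q≤b b<n

      v+g<n : v + g < n
      v+g<n = ≤-<-trans (m≤m+n (v + g) q) v+g+q<n

      v+q+g<n : v + q + g < n
      v+q+g<n = subst (_< n) (sym v+q+g≡v+g+q) v+g+q<n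

    Agree-shiftʳ : Agree v (v + g) → Agree (v + q) (v + q + g)
    Agree-shiftʳ vg = Agree-trans (≤-<-trans (m≤m+n v g) v+g<n) (Agree-sym Agree-v)
                        (Agree-trans v+g<n vg Agree-v+g)

    Agree-shiftˡ : Agree (v + q) (v + q + g) → Agree v (v + g)
    Agree-shiftˡ vqg = Agree-trans (≤-<-trans (m≤m+n (v + q) g) v+q+g<n) Agree-v
                         (Agree-trans v+q+g<n vqg (Agree-sym Agree-v+g))

  Periodic-extendʳ-step : ∀ {a b q c d g} → b < n → 0 < q → Periodic a b q → a ≤ c → suc d ≤ b →
                          c + q + g ≤ suc d → Periodic c d g → Periodic c (suc d) g
  Periodic-extendʳ-step {a} {b} {q} {c} {d} {g} b<n q>0 Q a≤c d<b long G u c≤u u+g≤1+d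
    with m≤n⇒m<n∨m≡n u+g≤1+d
  ... | inj₁ u+g<1+d = G u c≤u (s≤s⁻¹ u+g<1+d)
  ... | inj₂ u+g≡1+d =
    subst₂ Agree w+q≡u (cong (_+ g) w+q≡u) (Agree-shiftʳ b<n Q a≤w w+g+q≤b (G w c≤w w+g≤d))
    where
      c+q≤u : c + q ≤ u
      c+q≤u = +-cancelʳ-≤ g (c + q) u (subst (c + q + g ≤_) (sym u+g≡1+d) long)
      w : ℕ
      w = u ∸ q
      w+q≡u : w + q ≡ u
      w+q≡u = m∸n+n≡m (≤-trans (m≤n+m q c) c+q≤u)
      c≤w : c ≤ w
      c≤w = +-cancelʳ-≤ q c w (subst (c + q ≤_) (sym w+q≡u) c+q≤u)
      a≤w : a ≤ w
      a≤w = ≤-trans a≤c c≤w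
      w+g+q≡1+d : w + g + q ≡ suc d
      w+g+q≡1+d = trans (xy∙z≈xz∙y w g q) (trans (cong (_+ g) w+q≡u) u+g≡1+d)
      w+g+q≤b : w + g + q ≤ b
      w+g+q≤b = subst (_≤ b) (sym w+g+q≡1+d) d<b
      w+g≤d : w + g ≤ d
      w+g≤d = s≤s⁻¹ (subst (w + g <_) w+g+q≡1+d (m<m+n (w + g) q>0))

  Periodic-extendˡ-step : ∀ {a b q c d g} → b < n → 0 < q → Periodic a b q → a ≤ c → d ≤ b →
                          suc c + q + g ≤ suc d → Periodic (suc c) d g → Periodic c d g
  Periodic-extendˡ-step {b = b} {q} {c} {d} {g} b<n q>0 Q a≤c d≤b long G u c≤u u+g≤d
    with m≤n⇒m<n∨m≡n c≤u
  ... | inj₁ c<u = G u c<u u+g≤d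
  ... | inj₂ refl = Agree-shiftˡ b<n Q a≤c c+g+q≤b (G (c + q) (m<m+n c q>0) (s≤s⁻¹ long))
    where
      c+g+q≤b : c + g + q ≤ b
      c+g+q≤b = ≤-trans (subst (_≤ d) (xy∙z≈xz∙y c q g) (s≤s⁻¹ long)) d≤b

  Periodic-extendʳ : ∀ {a b q c d g} → b < n → 0 < q → Periodic a b q → a ≤ c → d ≤ b →
                     c + q + g ≤ suc d → Periodic c d g → Periodic c b g
  Periodic-extendʳ {a} {q = q} {c} {d} {g} b<n q>0 Q a≤c d≤b long G = go (≤⇒≤′ d≤b) b<n Q
    where
      go : ∀ {e} → d ≤′ e → e < n → Periodic a e q → Periodic c e g
      go ≤′-refl _ _ = G
      go {suc e} (≤′-step d≤′e) 1+e<n Q′ =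
        Periodic-extendʳ-step 1+e<n q>0 Q′ a≤c ≤-refl (≤-trans long (s≤s (≤′⇒≤ d≤′e)))
          (go d≤′e (≤-<-trans (n≤1+n e) 1+e<n) (Periodic-mono ≤-refl (n≤1+n e) Q′))

  Periodic-extendˡ : ∀ {a b q c g} → b < n → 0 < q → Periodic a b q → a ≤ c →
                     c + q + g ≤ suc b → Periodic c b g → Periodic a b g
  Periodic-extendˡ {a} {b} {q} {g = g} b<n q>0 Q a≤c = go (≤⇒≤′ a≤c)
    where
      go : ∀ {c} → a ≤′ c → c + q + g ≤ suc b → Periodic c b g → Periodic a b g
      go ≤′-refl _ G = G
      go {suc c} (≤′-step a≤′c) long G =
        go a≤′c (≤-trans (n≤1+n _) long) (Periodic-extendˡ-step b<n q>0 Q (≤′⇒≤ a≤′c) ≤-refl long G)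

  Periodic-extend : ∀ {a b q c d g} → b < n → 0 < q → Periodic a b q → a ≤ c → d ≤ b →
                    c + q + g ≤ suc d → Periodic c d g → Periodic a b g
  Periodic-extend b<n q>0 Q a≤c d≤b long G =
    Periodic-extendˡ b<n q>0 Q a≤c (≤-trans long (s≤s d≤b)) (Periodic-extendʳ b<n q>0 Q a≤c d≤b long G)

  Periodic-difference : ∀ {c d p g} → d < n → Periodic c d p → Periodic c d (p + g) →
                        c + p + (p + g) ≤ suc d → Periodic c d g
  Periodic-difference {c} {d} {p} {g} d<n P Q long u c≤u u+g≤d with u + (p + g) ≤? d
  ... | yes u+[p+g]≤d =
    Agree-trans (≤-<-trans u+[p+g]≤d d<n) (Q u c≤u u+[p+g]≤d)
      (Agree-sym (subst (Agree (u + g)) u+g+p≡u+[p+g]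
        (P (u + g) (≤-trans c≤u (m≤m+n u g)) (subst (_≤ d) (sym u+g+p≡u+[p+g]) u+[p+g]≤d))))
    where
      u+g+p≡u+[p+g] : u + g + p ≡ u + (p + g)
      u+g+p≡u+[p+g] = solve (u ∷ g ∷ p ∷ [])
  ... | no u+[p+g]≰d =
    subst₂ Agree w+p≡u (trans (sym (+-assoc w p g)) (cong (_+ g) w+p≡u))
      (Agree-trans (≤-<-trans w≤d d<n) (Agree-sym (P w c≤w w+p≤d)) (Q w c≤w w+[p+g]≤d))
    where
      c+p≤u : c + p ≤ u
      c+p≤u = +-cancelʳ-≤ (p + g) (c + p) u (≤-trans long (≰⇒> u+[p+g]≰d))
      w : ℕ
      w = u ∸ p
      w+p≡u : w + p ≡ u
      w+p≡u = m∸n+n≡m (≤-trans (m≤n+m p c) c+p≤u)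
      c≤w : c ≤ w
      c≤w = +-cancelʳ-≤ p c w (subst (c + p ≤_) (sym w+p≡u) c+p≤u)
      w+p≤d : w + p ≤ d
      w+p≤d = subst (_≤ d) (sym w+p≡u) (≤-trans (m≤m+n u g) u+g≤d)
      w≤d : w ≤ d
      w≤d = ≤-trans (m≤m+n w p) w+p≤d
      w+[p+g]≤d : w + (p + g) ≤ d
      w+[p+g]≤d = subst (_≤ d) (trans (cong (_+ g) (sym w+p≡u)) (+-assoc w p g)) u+g≤d

  IsRunWithPer⇒0<p : ∀ {i j p} → IsRunWithPer S i j p → 0 < p
  IsRunWithPer⇒0<p (_ , _ , ((p>0 , _) , _) , _) = p>0

  LeftMaximal : ℕ → ℕ → Set
  LeftMaximal i p = (a b : Fin n) → suc (toℕ a) ≡ i → toℕ b ≡ toℕ a + p → S a ≢ S b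

  RightMaximal : ℕ → ℕ → Set
  RightMaximal j p = (a b : Fin n) → toℕ b ≡ suc j → toℕ b ≡ toℕ a + p → S a ≢ S b

  LeftMaximal⇒¬Agree : ∀ {u p} → u + p < n → LeftMaximal (suc u) p → ¬ Agree u (u + p)
  LeftMaximal⇒¬Agree {u} {p} u+p<n lmax agree =
    lmax (fromℕ< u<n) (fromℕ< u+p<n) (cong suc (toℕ-fromℕ< u<n))
      (trans (toℕ-fromℕ< u+p<n) (cong (_+ p) (sym (toℕ-fromℕ< u<n))))
      (agree _ _ (toℕ-fromℕ< u<n) (toℕ-fromℕ< u+p<n))
    where
      u<n : u < n
      u<n = ≤-<-trans (m≤m+n u p) u+p<n

  RightMaximal⇒¬Agree : ∀ {u p j} → u + p < n → u + p ≡ suc j → RightMaximal j p → ¬ Agree u (u + p)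
  RightMaximal⇒¬Agree {u} {p} u+p<n u+p≡1+j rmax agree =
    rmax (fromℕ< u<n) (fromℕ< u+p<n) (trans (toℕ-fromℕ< u+p<n) u+p≡1+j)
      (trans (toℕ-fromℕ< u+p<n) (cong (_+ p) (sym (toℕ-fromℕ< u<n))))
      (agree _ _ (toℕ-fromℕ< u<n) (toℕ-fromℕ< u+p<n))
    where
      u<n : u < n
      u<n = ≤-<-trans (m≤m+n u p) u+p<n

  LeftMaximal-≤ : ∀ {a b i p} → b < n → Periodic a b p → LeftMaximal i p → i + p ≤ suc b → i ≤ a
  LeftMaximal-≤ {i = zero} _ _ _ _ = z≤n
  LeftMaximal-≤ {a} {b} {suc u} {p} b<n P lmax 1+u+p≤1+b with a ≤? u
  ... | no a≰u = ≰⇒> a≰u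
  ... | yes a≤u = ⊥-elim (LeftMaximal⇒¬Agree (≤-<-trans u+p≤b b<n) lmax (P u a≤u u+p≤b))
    where
      u+p≤b : u + p ≤ b
      u+p≤b = s≤s⁻¹ 1+u+p≤1+b

  RightMaximal-≤ : ∀ {a b j p} → b < n → Periodic a b p → RightMaximal j p → a + p ≤ suc j → b ≤ j
  RightMaximal-≤ {a} {b} {j} {p} b<n P rmax a+p≤1+j with b ≤? j
  ... | yes b≤j = b≤j
  ... | no b≰j = ⊥-elim (RightMaximal⇒¬Agree (≤-<-trans u+p≤b b<n) u+p≡1+j rmax (P u a≤u u+p≤b))
    where
      u : ℕ
      u = suc j ∸ p
      u+p≡1+j : u + p ≡ suc j
      u+p≡1+j = m∸n+n≡m (≤-trans (m≤n+m p a) a+p≤1+j)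
      a≤u : a ≤ u
      a≤u = +-cancelʳ-≤ p a u (subst (a + p ≤_) (sym u+p≡1+j) a+p≤1+j)
      u+p≤b : u + p ≤ b
      u+p≤b = subst (_≤ b) (sym u+p≡1+j) (≰⇒> b≰j)

  equal-period-runs-coincide : ∀ {a₁ b₁ a₂ b₂ p c d} →
    IsRunWithPer S a₁ b₁ p → IsRunWithPer S a₂ b₂ p →
    a₁ ≤ c → a₂ ≤ c → d ≤ b₁ → d ≤ b₂ → c + p ≤ suc d → (a₁ , b₁) ≡ (a₂ , b₂)
  equal-period-runs-coincide {p = p} {c} {d}
    (_ , b₁<n , (per₁ , _) , _ , lmax₁ , rmax₁) (_ , b₂<n , (per₂ , _) , _ , lmax₂ , rmax₂)
    a₁≤c a₂≤c d≤b₁ d≤b₂ long =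
      cong₂ _,_
        (≤-antisym (LeftMaximal-≤ b₂<n P₂ lmax₁ (fits a₁≤c d≤b₂)) (LeftMaximal-≤ b₁<n P₁ lmax₂ (fits a₂≤c d≤b₁)))
        (≤-antisym (RightMaximal-≤ b₁<n P₁ rmax₂ (fits a₁≤c d≤b₂)) (RightMaximal-≤ b₂<n P₂ rmax₁ (fits a₂≤c d≤b₁)))
    where
      P₁ = IsPeriod⇒Periodic per₁
      P₂ = IsPeriod⇒Periodic per₂
      fits : ∀ {a b} → a ≤ c → d ≤ b → a + p ≤ suc b
      fits a≤c d≤b = ≤-trans (+-monoˡ-≤ p a≤c) (≤-trans long (s≤s d≤b))

  close-period-runs-absurd : ∀ {a₁ b₁ a₂ b₂ p g c d} →
    IsRunWithPer S a₁ b₁ p → IsRunWithPer S a₂ b₂ (p + g) → 0 < g → g ≤ p →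
    a₁ ≤ c → a₂ ≤ c → d ≤ b₁ → d ≤ b₂ → c + (p + (p + g)) ≤ suc d → ⊥
  close-period-runs-absurd {a₂ = a₂} {b₂} {p} {g} {c} {d}
    (_ , b₁<n , (per₁ , _) , _) (_ , b₂<n , (per₂ , minimal₂) , _) g>0 g≤p a₁≤c a₂≤c d≤b₁ d≤b₂ long =
      <⇒≱ (m<n+m g (proj₁ per₁)) (minimal₂ g (Periodic⇒IsPeriod g>0 G₂))
    where
      P₁ = IsPeriod⇒Periodic per₁
      P₂ = IsPeriod⇒Periodic per₂
      G : Periodic c d g
      G = Periodic-difference (≤-<-trans d≤b₁ b₁<n) (Periodic-mono a₁≤c d≤b₁ P₁) (Periodic-mono a₂≤c d≤b₂ P₂)
            (subst (_≤ suc d) (sym (+-assoc c p (p + g))) long)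
      c+[g+[p+g]]≡c+[p+g]+g : c + (g + (p + g)) ≡ c + (p + g) + g
      c+[g+[p+g]]≡c+[p+g]+g = solve (c ∷ g ∷ p ∷ [])
      c+[p+g]+g≤c+[p+[p+g]] : c + (p + g) + g ≤ c + (p + (p + g))
      c+[p+g]+g≤c+[p+[p+g]] =
        subst (_≤ c + (p + (p + g))) c+[g+[p+g]]≡c+[p+g]+g (+-monoʳ-≤ c (+-monoˡ-≤ (p + g) g≤p))
      G₂ : Periodic a₂ b₂ g
      G₂ = Periodic-extend b₂<n (proj₁ per₂) P₂ a₂≤c d≤b₂ (≤-trans c+[p+g]+g≤c+[p+[p+g]] long) G

  close-period-runs-coincide : ∀ {a₁ b₁ p a₂ b₂ q c d} →
    IsRunWithPer S a₁ b₁ p → IsRunWithPer S a₂ b₂ q → p ≤ q → q ≤ p + p →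
    a₁ ≤ c → a₂ ≤ c → d ≤ b₁ → d ≤ b₂ → c + (p + q) ≤ suc d → (a₁ , b₁) ≡ (a₂ , b₂)
  close-period-runs-coincide {p = p} {c = c} run₁ run₂ p≤q q≤p+p a₁≤c a₂≤c d≤b₁ d≤b₂ long
    with m≤n⇒∃[o]m+o≡n p≤q
  ... | zero , refl =
    equal-period-runs-coincide run₁ (subst (IsRunWithPer S _ _) (+-identityʳ p) run₂) a₁≤c a₂≤c d≤b₁ d≤b₂
      (≤-trans (+-monoʳ-≤ c (m≤m+n p _)) long)
  ... | suc g , refl =
    ⊥-elim (close-period-runs-absurd run₁ run₂ z<s (+-cancelˡ-≤ p _ _ q≤p+p) a₁≤c a₂≤c d≤b₁ d≤b₂ long)

module RunsAround {A : Set} {n : ℕ} (S : Fin n → A) (x : ℕ) where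

  Around : ℕ × ℕ → Set
  Around r = IsExtremelyPeriodicRun S (proj₁ r) (proj₂ r) × proj₁ r ≤ x × x ≤ proj₂ r

  x-in-left-half-runs-coincide : ∀ {i₁ j₁ p₁ i₂ j₂ p₂} →
    IsRunWithPer S i₁ j₁ p₁ → 5 * p₁ + i₁ ≤ suc j₁ → i₁ ≤ x → x + x ≤ i₁ + j₁ →
    IsRunWithPer S i₂ j₂ p₂ → 5 * p₂ + i₂ ≤ suc j₂ → i₂ ≤ x → x + x ≤ i₂ + j₂ →
    Close p₁ p₂ → (i₁ , j₁) ≡ (i₂ , j₂)
  x-in-left-half-runs-coincide {i₁} {j₁} {p₁} {i₂} {j₂} {p₂}
    run₁ long₁ i₁≤x half₁ run₂ long₂ i₂≤x half₂ close =
    [ (λ j₁≤j₂ → coincide ≤-refl j₁≤j₂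
                   (x+x≤i+j⇒x+s≤1+j {p₁} {x = x} {s = p₁ + p₂} long₁ half₁ (Close⇒2*[p+q]≤5*p+1 close)))
    , (λ j₂≤j₁ → coincide j₂≤j₁ ≤-refl
                   (x+x≤i+j⇒x+s≤1+j {p₂} {x = x} {s = p₁ + p₂} long₂ half₂ (Close⇒2*[p+q]≤5*q+1 close)))
    ]′ (≤-total j₁ j₂)
    where
      coincide : ∀ {d} → d ≤ j₁ → d ≤ j₂ → x + (p₁ + p₂) ≤ suc d → (i₁ , j₁) ≡ (i₂ , j₂)
      coincide = close-period-runs-coincide S run₁ run₂ (proj₁ close)
                   (Close⇒q≤p+p (IsRunWithPer⇒0<p S run₁) close) i₁≤x i₂≤x

  x-in-right-half-runs-coincide : ∀ {i₁ j₁ p₁ i₂ j₂ p₂} →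
    IsRunWithPer S i₁ j₁ p₁ → 5 * p₁ + i₁ ≤ suc j₁ → x ≤ j₁ → i₁ + j₁ < x + x →
    IsRunWithPer S i₂ j₂ p₂ → 5 * p₂ + i₂ ≤ suc j₂ → x ≤ j₂ → i₂ + j₂ < x + x →
    Close p₁ p₂ → (i₁ , j₁) ≡ (i₂ , j₂)
  x-in-right-half-runs-coincide {i₁} {j₁} {p₁} {i₂} {j₂} {p₂}
    run₁ long₁ x≤j₁ half₁ run₂ long₂ x≤j₂ half₂ close =
    [ (λ i₁≤i₂ → coincide i₁≤i₂ ≤-refl
                   (i+j<x+x⇒i+s≤1+x {p₂} {x = x} {s = p₁ + p₂} long₂ half₂ (Close⇒2*[p+q]≤5*q+1 close)))
    , (λ i₂≤i₁ → coincide ≤-refl i₂≤i₁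
                   (i+j<x+x⇒i+s≤1+x {p₁} {x = x} {s = p₁ + p₂} long₁ half₁ (Close⇒2*[p+q]≤5*p+1 close)))
    ]′ (≤-total i₁ i₂)
    where
      coincide : ∀ {c} → i₁ ≤ c → i₂ ≤ c → c + (p₁ + p₂) ≤ suc x → (i₁ , j₁) ≡ (i₂ , j₂)
      coincide i₁≤c i₂≤c = close-period-runs-coincide S run₁ run₂ (proj₁ close)
                             (Close⇒q≤p+p (IsRunWithPer⇒0<p S run₁) close) i₁≤c i₂≤c x≤j₁ x≤j₂

  K : ℕ
  K = 2 * ⌊log₂ n ⌋ + 3

  ⌊log₂[p*p]⌋<K : ∀ {i j p} → IsRunWithPer S i j p → 5 * p + i ≤ suc j → ⌊log₂ (p * p) ⌋ < K
  ⌊log₂[p*p]⌋<K {i} {p = p} (_ , j<n , _) long =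
    ≤-trans (s≤s (⌊log₂[m*m]⌋≤2*⌊log₂n⌋+2 p≤n)) (≤-reflexive (sym (+-suc (2 * ⌊log₂ n ⌋) 2)))
    where
      p≤n : p ≤ n
      p≤n = ≤-trans (≤-trans (m≤m+n p (4 * p)) (m≤m+n (5 * p) i)) (≤-trans long j<n)

  runClass : ∀ r → Around r → ℕ
  runClass (i , j) ((p , _) , _) with x + x ≤? i + j
  ... | yes _ = ⌊log₂ (p * p) ⌋
  ... | no  _ = K + ⌊log₂ (p * p) ⌋

  runClass<K+K : ∀ r (around : Around r) → runClass r around < K + K
  runClass<K+K (i , j) ((p , run , long) , _) with x + x ≤? i + j
  ... | yes _ = ≤-trans (⌊log₂[p*p]⌋<K run long) (m≤m+n K K)
  ... | no  _ = +-monoʳ-< K (⌊log₂[p*p]⌋<K run long)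

  runClass-injective : ∀ r₁ r₂ (around₁ : Around r₁) (around₂ : Around r₂) →
                       runClass r₁ around₁ ≡ runClass r₂ around₂ → r₁ ≡ r₂
  runClass-injective (i₁ , j₁) (i₂ , j₂)
    ((p₁ , run₁ , long₁) , i₁≤x , x≤j₁) ((p₂ , run₂ , long₂) , i₂≤x , x≤j₂) eq
    with x + x ≤? i₁ + j₁ | x + x ≤? i₂ + j₂
  ... | yes half₁ | yes half₂ =
    wlog-Close (IsRunWithPer⇒0<p S run₁) (IsRunWithPer⇒0<p S run₂) eq
      (x-in-left-half-runs-coincide run₁ long₁ i₁≤x half₁ run₂ long₂ i₂≤x half₂)
      (x-in-left-half-runs-coincide run₂ long₂ i₂≤x half₂ run₁ long₁ i₁≤x half₁)
  ... | no half₁ | no half₂ =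
    wlog-Close (IsRunWithPer⇒0<p S run₁) (IsRunWithPer⇒0<p S run₂) (+-cancelˡ-≡ K _ _ eq)
      (x-in-right-half-runs-coincide run₁ long₁ x≤j₁ (≰⇒> half₁) run₂ long₂ x≤j₂ (≰⇒> half₂))
      (x-in-right-half-runs-coincide run₂ long₂ x≤j₂ (≰⇒> half₂) run₁ long₁ x≤j₁ (≰⇒> half₁))
  ... | yes _ | no _ = ⊥-elim (<⇒≱ (⌊log₂[p*p]⌋<K run₁ long₁) (subst (K ≤_) (sym eq) (m≤m+n K _)))
  ... | no _ | yes _ = ⊥-elim (<⇒≱ (⌊log₂[p*p]⌋<K run₂ long₂) (subst (K ≤_) eq (m≤m+n K _)))

mainTheorem7 : Σ ℕ λ C → Σ ℕ λ N → (A : Set) → (n : ℕ) → N ≤ n →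
    (S : Fin n → A) → (x : Fin n) → (rs : List (ℕ × ℕ)) → Unique rs →
    All (λ r → IsExtremelyPeriodicRun S (proj₁ r) (proj₂ r) × proj₁ r ≤ toℕ x × toℕ x ≤ proj₂ r) rs →
    length rs ≤ C * ⌊log₂ n ⌋
mainTheorem7 = 10 , 2 , λ A n 2≤n S x rs unique around → let open RunsAround S (toℕ x) in begin
  length rs        ≤⟨ length≤-by-injective-code (K + K) unique around runClass runClass<K+K runClass-injective ⟩
  K + K            ≤⟨ 2*L+3+[2*L+3]≤10*L (subst (_≤ ⌊log₂ n ⌋) (⌊log₂[2^n]⌋≡n 1) (⌊log₂⌋-mono-≤ 2≤n)) ⟩
  10 * ⌊log₂ n ⌋   ∎
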